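{- For any strings $S$ and $T$ over a finite alphabet, $0\le \mathrm{NCD}_\delta(S,T)\le 1$.
   Context: For a string $S$ of length $n$ and $k\ge1$, $D_k(S)$ is the set of distinct length-$k$ substrings of $S$ (empty if $k>n$), $d_k(S)=|D_k(S)|$, and $\delta(S)=\max_{k\ge1} d_k(S)/k$. For two strings, $\delta(S,T)=\max_{k\ge1}|D_k(S)\cup D_k(T)|/k$. For a measure $Z$ defined on single strings and on pairs of strings, the normalized compression distance is \[ \mathrm{NCD}_Z(S,T)=\frac{Z(S,T)-\min\{Z(S),Z(T)\}}{\max\{Z(S),Z(T)\}}. \] -}

module Defs where

open import Data.Nat as ℕ using (ℕ; zero; suc)
open import Data.Fin using (Fin)
import Data.Fin.Properties as FinP
open import Data.List using (List; []; _∷_; length; take; drop; map; deduplicate; _++_; foldr; applyUpTo)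
import Data.List.Properties as ListP
open import Data.Integer using (+_)
open import Data.Rational using (ℚ; 0ℚ; _/_; _⊔_; _⊓_; _-_; _÷_; NonZero)

Str : ℕ → Set
Str σ = List (Fin σ)

_≟ₛ_ : ∀ {σ} → (u v : Str σ) → _
_≟ₛ_ {σ} = ListP.≡-dec FinP._≟_

-- All length-k substrings (with repetitions): S[i..i+k-1] for 0 ≤ i ≤ n-k;
-- empty list when k > n.
substrs : ∀ {σ} → ℕ → Str σ → List (Str σ)
substrs k S = map (λ i → take k (drop i S)) (applyUpTo (λ i → i) (suc (length S) ℕ.∸ k)) 


D : ∀ {σ} → ℕ → Str σ → List (Str σ)
D k S = deduplicate _≟ₛ_ (substrs k S)

d : ∀ {σ} → ℕ → Str σ → ℕ
d k S = length (D k S)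

d₂ : ∀ {σ} → ℕ → Str σ → Str σ → ℕ
d₂ k S T = length (deduplicate _≟ₛ_ (substrs k S ++ substrs k T))

-- maximum of f(k) over 1 ≤ k ≤ n (and 0, which is harmless as all values are ≥ 0
-- and is the correct value when n = 0, since then d_k = 0 for all k ≥ 1)
maxUpTo : ℕ → (ℕ → ℚ) → ℚ
maxUpTo zero    f = 0ℚ
maxUpTo (suc n) f = f (suc n) ⊔ maxUpTo n f

-- δ(S) = max_{k ≥ 1} d_k(S)/k ; for k > |S| the ratio is 0, so k ≤ |S| suffices.
δ : ∀ {σ} → Str σ → ℚ
δ S = maxUpTo (length S) (λ { zero → 0ℚ ; (suc j) → (+ d (suc j) S) / suc j })

-- δ(S,T) = max_{k ≥ 1} |D_k(S) ∪ D_k(T)|/k ; for k > max(|S|,|T|) the ratio is 0.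
δ₂ : ∀ {σ} → Str σ → Str σ → ℚ
δ₂ S T = maxUpTo (length S ℕ.⊔ length T) (λ { zero → 0ℚ ; (suc j) → (+ d₂ (suc j) S T) / suc j })

NCD : (zST zS zT : ℚ) → .{{_ : NonZero (zS ⊔ zT)}} → ℚ
NCD zST zS zT = (zST - (zS ⊓ zT)) ÷ (zS ⊔ zT)

NCDδ : ∀ {σ} → (S T : Str σ) → .{{_ : NonZero (δ S ⊔ δ T)}} → ℚ
NCDδ S T = NCD (δ₂ S T) (δ S) (δ T)

{-# OPTIONS --safe #-}
-- For every k, D_k(S) and D_k(T) are subsets of D_k(S) ∪ D_k(T), whose size is at
-- most d_k(S) + d_k(T); dividing by k and maximising gives
-- max{δ(S), δ(T)} ≤ δ(S,T) ≤ δ(S) + δ(T).  Since δ(S) + δ(T) = max + min, the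
-- numerator of NCD_δ then lies between 0 and max{δ(S), δ(T)}.
module Submission where

open import Defs

open import Data.Empty using (⊥-elim)
open import Data.Integer as ℤ using (+_)
import Data.Integer.Properties as ℤ
open import Data.Integer.Tactic.RingSolver using (solve-∀)
open import Data.List using (List; []; _∷_; length; _++_; deduplicate)
open import Data.List.Properties using (length-++; length-removeAt′)
open import Data.List.Membership.Propositional using (_∈_; _─_)
open import Data.List.Membership.Propositional.Properties
  using (∈-++⁺ˡ; ∈-++⁺ʳ; ∈-++⁻; ∈-deduplicate⁻; ∈-deduplicate⁺)
open import Data.List.Relation.Binary.Subset.Propositional using (_⊆_)
import Data.List.Relation.Unary.All as All
open import Data.List.Relation.Unary.AllPairs using (_∷_)
open import Data.List.Relation.Unary.Any using (here; there; index)
open import Data.List.Relation.Unary.Unique.Propositional using (Unique)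
open import Data.List.Relation.Unary.Unique.DecPropositional.Properties using (deduplicate-!)
open import Data.Nat as ℕ using (ℕ; zero; suc; s≤s; z≤n)
import Data.Nat.Properties as ℕ
open import Data.Product using (_×_; _,_)
open import Data.Rational
open import Data.Rational.Properties
import Data.Rational.Unnormalised as ℚᵘ
import Data.Rational.Unnormalised.Properties as ℚᵘ
open import Data.Sum using ([_,_]′; inj₁; inj₂)
open import Function using (_∘′_)
open import Relation.Binary.Definitions using (DecidableEquality)
open import Relation.Binary.PropositionalEquality
open import Relation.Nullary using (yes; no)

module _ {A : Set} where

  ∈-─⁺ : ∀ {x z : A} {ys : List A} (x∈ys : x ∈ ys) → x ≢ z → z ∈ ys → z ∈ ys ─ x∈ys
  ∈-─⁺ (here refl) x≢z (here refl) = ⊥-elim (x≢z refl)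
  ∈-─⁺ (here refl) x≢z (there z∈ys) = z∈ys
  ∈-─⁺ (there x∈ys) x≢z (here refl) = here refl
  ∈-─⁺ (there x∈ys) x≢z (there z∈ys) = there (∈-─⁺ x∈ys x≢z z∈ys)

  Unique-⊆⇒length≤ : ∀ {xs ys : List A} → Unique xs → xs ⊆ ys → length xs ℕ.≤ length ys
  Unique-⊆⇒length≤ {[]} _ _ = z≤n
  Unique-⊆⇒length≤ {x ∷ xs} {ys} (x∉xs ∷ !xs) xs⊆ys =
    subst (suc (length xs) ℕ.≤_) (sym (length-removeAt′ ys (index x∈ys)))
      (s≤s (Unique-⊆⇒length≤ !xs (λ z∈xs → ∈-─⁺ x∈ys (All.lookup x∉xs z∈xs) (xs⊆ys (there z∈xs)))))
    where
    x∈ys : x ∈ ys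
    x∈ys = xs⊆ys (here refl)

module _ {A : Set} (_≟_ : DecidableEquality A) where

  length-deduplicate-mono : ∀ {xs ys : List A} → xs ⊆ ys →
    length (deduplicate _≟_ xs) ℕ.≤ length (deduplicate _≟_ ys)
  length-deduplicate-mono {xs} xs⊆ys = Unique-⊆⇒length≤ (deduplicate-! _≟_ xs)
    (∈-deduplicate⁺ _≟_ ∘′ xs⊆ys ∘′ ∈-deduplicate⁻ _≟_ xs)

  length-deduplicate-++ : ∀ (xs ys : List A) → length (deduplicate _≟_ (xs ++ ys)) ℕ.≤
    length (deduplicate _≟_ xs) ℕ.+ length (deduplicate _≟_ ys)
  length-deduplicate-++ xs ys = subst (length (deduplicate _≟_ (xs ++ ys)) ℕ.≤_)
    (length-++ (deduplicate _≟_ xs))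
    (Unique-⊆⇒length≤ (deduplicate-! _≟_ (xs ++ ys))
      ([ ∈-++⁺ˡ ∘′ ∈-deduplicate⁺ _≟_ , ∈-++⁺ʳ _ ∘′ ∈-deduplicate⁺ _≟_ ]′
        ∘′ ∈-++⁻ xs ∘′ ∈-deduplicate⁻ _≟_ (xs ++ ys)))

toℚᵘ-/ : ∀ i n .{{_ : ℕ.NonZero n}} → toℚᵘ (i / n) ℚᵘ.≃ (i ℚᵘ./ n)
toℚᵘ-/ i (suc j) = toℚᵘ-fromℚᵘ (ℚᵘ.mkℚᵘ i j)

/-monoˡ-≤ : ∀ {i i′} n .{{_ : ℕ.NonZero n}} → i ℤ.≤ i′ → i / n ≤ i′ / n
/-monoˡ-≤ {i} {i′} n@(suc _) i≤i′ = toℚᵘ-cancel-≤ (begin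
  toℚᵘ (i / n)   ≃⟨ toℚᵘ-/ i n ⟩
  i ℚᵘ./ n       ≤⟨ ℚᵘ.*≤* (ℤ.*-monoʳ-≤-nonNeg (+ n) i≤i′) ⟩
  i′ ℚᵘ./ n      ≃⟨ toℚᵘ-/ i′ n ⟨
  toℚᵘ (i′ / n)  ∎)
  where open ℚᵘ.≤-Reasoning

/-distribʳ-+ : ∀ i i′ n .{{_ : ℕ.NonZero n}} → (i ℤ.+ i′) / n ≡ i / n + i′ / n
/-distribʳ-+ i i′ n@(suc _) = toℚᵘ-injective (begin-equality
  toℚᵘ ((i ℤ.+ i′) / n)            ≃⟨ toℚᵘ-/ (i ℤ.+ i′) n ⟩
  (i ℤ.+ i′) ℚᵘ./ n                ≃⟨ ℚᵘ.*≡* (ring i i′ (+ n)) ⟩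
  i ℚᵘ./ n ℚᵘ.+ i′ ℚᵘ./ n          ≃⟨ ℚᵘ.+-cong (toℚᵘ-/ i n) (toℚᵘ-/ i′ n) ⟨
  toℚᵘ (i / n) ℚᵘ.+ toℚᵘ (i′ / n)  ≃⟨ toℚᵘ-homo-+ (i / n) (i′ / n) ⟨
  toℚᵘ (i / n + i′ / n)            ∎)
  where
  open ℚᵘ.≤-Reasoning
  ring : ∀ x y m → (x ℤ.+ y) ℤ.* (m ℤ.* m) ≡ (x ℤ.* m ℤ.+ y ℤ.* m) ℤ.* m
  ring = solve-∀

p⊔q+p⊓q≡p+q : ∀ p q → p ⊔ q + p ⊓ q ≡ p + q
p⊔q+p⊓q≡p+q p q with ≤-total p q
... | inj₁ p≤q rewrite p≤q⇒p⊔q≡q p≤q | p≤q⇒p⊓q≡p p≤q = +-comm q p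
... | inj₂ q≤p rewrite p≥q⇒p⊔q≡p q≤p | p≥q⇒p⊓q≡q q≤p = refl

NCD-bounded : ∀ a x y .{{_ : NonZero (x ⊔ y)}} → 0ℚ ≤ x → x ⊔ y ≤ a → a ≤ x + y →
  0ℚ ≤ NCD a x y × NCD a x y ≤ 1ℚ
NCD-bounded a x y 0≤x max≤a a≤x+y =
  nonNegative⁻¹ ((a - min) ÷ max)
    {{nonNeg*nonNeg⇒nonNeg (a - min) {{nonNegative 0≤a-min}} (1/ max) {{0≤1/max}}}} ,
  (begin
    (a - min) * 1/ max  ≤⟨ *-monoʳ-≤-nonNeg (1/ max) {{0≤1/max}} a-min≤max ⟩
    max * 1/ max        ≡⟨ *-inverseʳ max ⟩
    1ℚ                  ∎)
  where
  open ≤-Reasoning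
  max min : ℚ
  max = x ⊔ y
  min = x ⊓ y
  0≤1/max : NonNegative (1/ max)
  0≤1/max = pos⇒nonNeg (1/ max) {{1/max>0}}
    where
    1/max>0 : Positive (1/ max)
    1/max>0 = 1/pos⇒pos max {{nonNeg∧nonZero⇒pos max {{nonNegative (≤-trans 0≤x (p≤p⊔q x y))}}}}
  0≤a-min : 0ℚ ≤ a - min
  0≤a-min = begin
    0ℚ         ≡⟨ +-inverseʳ min ⟨
    min - min  ≤⟨ +-monoˡ-≤ (- min) (≤-trans (p⊓q≤p⊔q x y) max≤a) ⟩
    a - min    ∎
  a-min≤max : a - min ≤ max
  a-min≤max = begin
    a - min            ≤⟨ +-monoˡ-≤ (- min) a≤x+y ⟩
    x + y - min        ≡⟨ cong (_- min) (p⊔q+p⊓q≡p+q x y) ⟨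
    max + min - min    ≡⟨ +-assoc max min (- min) ⟩
    max + (min - min)  ≡⟨ cong (λ r → max + r) (+-inverseʳ min) ⟩
    max + 0ℚ           ≡⟨ +-identityʳ max ⟩
    max                ∎

maxUpTo-nonNeg : ∀ n f → 0ℚ ≤ maxUpTo n f
maxUpTo-nonNeg zero    f = ≤-refl
maxUpTo-nonNeg (suc n) f = ≤-trans (maxUpTo-nonNeg n f) (p≤q⊔p (f (suc n)) _)

≤-maxUpTo : ∀ n f j → suc j ℕ.≤ n → f (suc j) ≤ maxUpTo n f
≤-maxUpTo (suc n) f j j<n with suc j ℕ.≟ suc n
... | yes refl = p≤p⊔q (f (suc n)) _
... | no  j≢n  = ≤-trans (≤-maxUpTo n f j (ℕ.≤-pred (ℕ.≤∧≢⇒< j<n j≢n))) (p≤q⊔p (f (suc n)) _)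

maxUpTo-lub : ∀ n f {X} → 0ℚ ≤ X → (∀ j → suc j ℕ.≤ n → f (suc j) ≤ X) → maxUpTo n f ≤ X
maxUpTo-lub zero    f 0≤X f≤X = 0≤X
maxUpTo-lub (suc n) f 0≤X f≤X =
  ⊔-lub (f≤X n ℕ.≤-refl) (maxUpTo-lub n f 0≤X (λ j j<n → f≤X j (ℕ.m≤n⇒m≤1+n j<n)))

module _ {σ : ℕ} where

  length<⇒d≡0 : ∀ k (S : Str σ) → length S ℕ.< k → d k S ≡ 0
  length<⇒d≡0 k S |S|<k rewrite ℕ.m≤n⇒m∸n≡0 |S|<k = refl

  d/k≤δ : ∀ (S : Str σ) j → + d (suc j) S / suc j ≤ δ S
  d/k≤δ S j with suc j ℕ.≤? length S
  ... | yes k≤|S| = ≤-maxUpTo (length S) _ j k≤|S|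
  ... | no  k≰|S| = begin
    + d (suc j) S / suc j  ≡⟨ cong (λ m → + m / suc j) (length<⇒d≡0 (suc j) S (ℕ.≰⇒> k≰|S|)) ⟩
    + 0 / suc j            ≡⟨ 0/n≡0 (suc j) ⟩
    0ℚ                     ≤⟨ maxUpTo-nonNeg (length S) _ ⟩
    δ S                    ∎
    where open ≤-Reasoning

  δ≤δ₂ : ∀ (S T U : Str σ) → (∀ k → d k U ℕ.≤ d₂ k S T) →
    length U ℕ.≤ length S ℕ.⊔ length T → δ U ≤ δ₂ S T
  δ≤δ₂ S T U dU≤d₂ |U|≤ = maxUpTo-lub (length U) _ (maxUpTo-nonNeg (length S ℕ.⊔ length T) _)
    λ j k≤|U| → ≤-trans (/-monoˡ-≤ (suc j) (ℤ.+≤+ (dU≤d₂ (suc j))))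
      (≤-maxUpTo (length S ℕ.⊔ length T) _ j (ℕ.≤-trans k≤|U| |U|≤))

  δˡ≤δ₂ : ∀ (S T : Str σ) → δ S ≤ δ₂ S T
  δˡ≤δ₂ S T = δ≤δ₂ S T S (λ k → length-deduplicate-mono _≟ₛ_ {substrs k S} ∈-++⁺ˡ) (ℕ.m≤m⊔n _ _)

  δʳ≤δ₂ : ∀ (S T : Str σ) → δ T ≤ δ₂ S T
  δʳ≤δ₂ S T = δ≤δ₂ S T T
    (λ k → length-deduplicate-mono _≟ₛ_ {substrs k T} (∈-++⁺ʳ (substrs k S))) (ℕ.m≤n⊔m _ _)

  δ₂≤δ+δ : ∀ (S T : Str σ) → δ₂ S T ≤ δ S + δ T
  δ₂≤δ+δ S T = maxUpTo-lub (length S ℕ.⊔ length T) _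
    (+-mono-≤ (maxUpTo-nonNeg (length S) _) (maxUpTo-nonNeg (length T) _)) λ j _ → begin
      + d₂ (suc j) S T / suc j                      ≤⟨ /-monoˡ-≤ (suc j) (ℤ.+≤+ (d₂≤d+d j)) ⟩
      + (d (suc j) S ℕ.+ d (suc j) T) / suc j        ≡⟨ cong (_/ suc j) (ℤ.pos-+ (d (suc j) S) _) ⟩
      (+ d (suc j) S ℤ.+ + d (suc j) T) / suc j     ≡⟨ /-distribʳ-+ (+ d (suc j) S) (+ d (suc j) T) (suc j) ⟩
      + d (suc j) S / suc j + + d (suc j) T / suc j  ≤⟨ +-mono-≤ (d/k≤δ S j) (d/k≤δ T j) ⟩
      δ S + δ T                                      ∎
    where
    open ≤-Reasoning
    d₂≤d+d : ∀ j → d₂ (suc j) S T ℕ.≤ d (suc j) S ℕ.+ d (suc j) T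
    d₂≤d+d j = length-deduplicate-++ _≟ₛ_ (substrs (suc j) S) (substrs (suc j) T)

corollary1 : (σ : ℕ) (S T : Str σ) .{{_ : NonZero (δ S ⊔ δ T)}} →
    (0ℚ ≤ NCDδ S T) × (NCDδ S T ≤ 1ℚ)
corollary1 σ S T = NCD-bounded (δ₂ S T) (δ S) (δ T) (maxUpTo-nonNeg (length S) _)
  (⊔-lub (δˡ≤δ₂ S T) (δʳ≤δ₂ S T)) (δ₂≤δ+δ S T)
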